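{- Let $S\subset \mathbb{Z}^n$ be a realizable set and let $(G,W)$ be a realization of $S$, where $G$ is regarded as a graph with vertex set $V(G)=S$ and $W=\{\omega^1,\dots,\omega^n\}$ is such that every $u\in S$ satisfies $r_G(u\mid W)=u$. If $x,y\in S$ are distinct with $xy\notin E(G)$, then $(G+xy,W)$ is a realization of $S$ if and only if $\max_{i\in [n]}|x_i-y_i|=1$.
   Context: All graphs are finite, simple and connected. For a graph $G$ and an ordered vertex subset $W=\{\omega^1,\dots,\omega^n\}\subseteq V(G)$, the metric representation of $u\in V(G)$ is $r_G(u\mid W)=(d_G(u,\omega^1),\dots,d_G(u,\omega^n))$. $W$ is a resolving set if $r_G(u\mid W)\neq r_G(v\mid W)$ for all distinct $u,v\in V(G)$. A finite set $S\subset\mathbb{Z}^n$ is realizable if there is a graph $G$ and a resolving set $W$ of $G$ with $S=\{r_G(u\mid W): u\in V(G)\}$; such a pair $(G,W)$ is a realization of $S$. Since the map $u\mapsto r_G(u\mid W)$ is a bijection onto $S$, realizations are identified with graphs on vertex set $S$ in which each vertex $u$ has representation $u$ (with $\omega^i$ the unique element of $S$ whose $i$-th coordinate is $0$). For $xy\notin E(G)$, $G+xy$ denotes the graph obtained by adding the edge $xy$. -}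

module Defs where

open import Data.Nat using (ℕ; zero; suc; _≤_; _⊔_)
open import Data.Integer using (ℤ; +_; ∣_∣; _-_)
open import Data.Vec using (Vec; lookup; zipWith; foldr′)
open import Data.Fin using (Fin)
open import Data.List using (List)
open import Data.List.Membership.Propositional using (_∈_)
open import Data.Product using (Σ; _×_)
open import Data.Sum using (_⊎_)
open import Relation.Binary.PropositionalEquality using (_≡_)
open import Relation.Nullary using (¬_)

Pt : ℕ → Set
Pt n = Vec ℤ n

Rel : ℕ → Set₁
Rel n = Pt n → Pt n → Set

IsGraphOn : ∀ {n} → List (Pt n) → Rel n → Set
IsGraphOn S E =
  (∀ u v → E u v → u ∈ S × v ∈ S) ×
  (∀ u → ¬ E u u) ×
  (∀ u v → E u v → E v u)

data Walk {n} (E : Rel n) : Pt n → Pt n → ℕ → Set where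
  here : ∀ {u} → Walk E u u 0
  step : ∀ {u v w k} → E u v → Walk E v w k → Walk E u w (suc k)

Dist : ∀ {n} → Rel n → Pt n → Pt n → ℕ → Set
Dist E u v k = Walk E u v k × (∀ k' → Walk E u v k' → k ≤ k')

Connected : ∀ {n} → List (Pt n) → Rel n → Set
Connected S E = ∀ u v → u ∈ S → v ∈ S → Σ ℕ λ k → Walk E u v k

-- (E , W) is a realization of S, where each vertex u ∈ S has
-- representation u, and ω^i is the element of S with i-th coordinate 0:
-- for each i there is ω^i ∈ S with ω^i_i = 0 and d(u, ω^i) = u_i for all u ∈ S.
-- (Uniqueness of ω^i and the resolving property follow automatically.)
IsRealization : ∀ {n} → List (Pt n) → Rel n → Set
IsRealization {n} S E =
  IsGraphOn S E × Connected S E ×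
  (∀ (i : Fin n) → Σ (Pt n) λ w → w ∈ S × lookup w i ≡ + 0 ×
     (∀ u → u ∈ S → Σ ℕ λ k → lookup u i ≡ + k × Dist E u w k))

addEdge : ∀ {n} → Rel n → Pt n → Pt n → Rel n
addEdge E x y u v = E u v ⊎ ((u ≡ x × v ≡ y) ⊎ (u ≡ y × v ≡ x))

-- max_{i ∈ [n]} |x_i - y_i|  (0 for n = 0)
maxAbsDiff : ∀ {n} → Pt n → Pt n → ℕ
maxAbsDiff x y = foldr′ _⊔_ 0 (zipWith (λ a b → ∣ a - b ∣) x y)

-- Every coordinate of a realization is 1-Lipschitz along the edges of the
-- graph, since it is a distance to a fixed vertex; conversely a coordinate
-- that is 1-Lipschitz along every edge is a lower bound for the length of
-- any walk to the vertex where it vanishes. So adding the edge xy keeps all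
-- distances to the ω^i exactly when it keeps every coordinate 1-Lipschitz,
-- i.e. when |x_i - y_i| ≤ 1 for all i, and for x ≠ y this means
-- max_i |x_i - y_i| = 1.
module Submission where

open import Defs
open import Data.Nat.Base as ℕ using (ℕ; suc; _⊔_; z≤n)
import Data.Nat.Properties as ℕ
open import Data.Integer.Base as ℤ using (ℤ; +_; -[1+_]; ∣_∣; _+_; _-_; -_; 1ℤ; +≤+; -≤+)
open import Data.Integer.Properties as ℤ using (+-monoˡ-≤; ∣i-j∣≡∣j-i∣; +∣i∣≡i⊎+∣i∣≡-i)
open import Data.Integer.Tactic.RingSolver using (solve-∀)
open import Data.Vec.Base using ([]; _∷_; lookup)
open import Data.Fin.Base using (Fin; zero; suc)
open import Data.List.Base using (List)
open import Data.List.Membership.Propositional using (_∈_)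
open import Data.Product.Base using (Σ; _×_; _,_)
open import Data.Sum.Base using (inj₁; inj₂)
open import Relation.Binary.PropositionalEquality using (_≡_; _≢_; refl; sym; trans; cong; cong₂; subst)
open import Relation.Nullary using (¬_; contradiction)

private
  variable
    n k : ℕ

i≤+∣i∣ : ∀ i → i ℤ.≤ + ∣ i ∣
i≤+∣i∣ (+ m)     = ℤ.≤-refl
i≤+∣i∣ -[1+ m ] = -≤+

i≡i-j+j : ∀ i j → i ≡ (i - j) + j
i≡i-j+j = solve-∀

1+j-j≡1 : ∀ j → (1ℤ + j) - j ≡ 1ℤ
1+j-j≡1 = solve-∀

-[i-j]≡j-i : ∀ i j → - (i - j) ≡ j - i
-[i-j]≡j-i = solve-∀

module _ {i j : ℤ} where
  open ℤ.≤-Reasoning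

  i-j≤1⇒i≤suc[j] : i - j ℤ.≤ 1ℤ → i ℤ.≤ ℤ.suc j
  i-j≤1⇒i≤suc[j] i-j≤1 = begin
    i           ≡⟨ i≡i-j+j i j ⟩
    (i - j) + j ≤⟨ +-monoˡ-≤ j i-j≤1 ⟩
    1ℤ + j      ∎

  i≤suc[j]⇒i-j≤1 : i ℤ.≤ ℤ.suc j → i - j ℤ.≤ 1ℤ
  i≤suc[j]⇒i-j≤1 i≤1+j = begin
    i - j        ≤⟨ +-monoˡ-≤ (- j) i≤1+j ⟩
    (1ℤ + j) - j ≡⟨ 1+j-j≡1 j ⟩
    1ℤ           ∎

∣i-j∣≤1⇒i≤suc[j] : ∀ {i j} → ∣ i - j ∣ ℕ.≤ 1 → i ℤ.≤ ℤ.suc j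
∣i-j∣≤1⇒i≤suc[j] {i} {j} ∣i-j∣≤1 =
  i-j≤1⇒i≤suc[j] (ℤ.≤-trans (i≤+∣i∣ (i - j)) (+≤+ ∣i-j∣≤1))

i≤suc[j]⇒j≤suc[i]⇒∣i-j∣≤1 : ∀ {i j} → i ℤ.≤ ℤ.suc j → j ℤ.≤ ℤ.suc i → ∣ i - j ∣ ℕ.≤ 1
i≤suc[j]⇒j≤suc[i]⇒∣i-j∣≤1 {i} {j} i≤1+j j≤1+i with +∣i∣≡i⊎+∣i∣≡-i (i - j)
... | inj₁ ∣i-j∣≡i-j = ℤ.drop‿+≤+ (subst (ℤ._≤ 1ℤ) (sym ∣i-j∣≡i-j) (i≤suc[j]⇒i-j≤1 i≤1+j))
... | inj₂ ∣i-j∣≡-[i-j] = ℤ.drop‿+≤+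
  (subst (ℤ._≤ 1ℤ) (sym (trans ∣i-j∣≡-[i-j] (-[i-j]≡j-i i j))) (i≤suc[j]⇒i-j≤1 j≤1+i))

∣lookup-lookup∣≤maxAbsDiff : (x y : Pt n) (i : Fin n) →
  ∣ lookup x i - lookup y i ∣ ℕ.≤ maxAbsDiff x y
∣lookup-lookup∣≤maxAbsDiff (a ∷ x) (b ∷ y) zero    = ℕ.m≤m⊔n _ _
∣lookup-lookup∣≤maxAbsDiff (a ∷ x) (b ∷ y) (suc i) =
  ℕ.≤-trans (∣lookup-lookup∣≤maxAbsDiff x y i) (ℕ.m≤n⊔m _ _)

maxAbsDiff-lub : ∀ {m} (x y : Pt n) → (∀ i → ∣ lookup x i - lookup y i ∣ ℕ.≤ m) →
  maxAbsDiff x y ℕ.≤ m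
maxAbsDiff-lub []      []      _     = z≤n
maxAbsDiff-lub (a ∷ x) (b ∷ y) bound =
  ℕ.⊔-lub (bound zero) (maxAbsDiff-lub x y (λ i → bound (suc i)))

maxAbsDiff≡0⇒≡ : (x y : Pt n) → maxAbsDiff x y ≡ 0 → x ≡ y
maxAbsDiff≡0⇒≡ []      []      _ = refl
maxAbsDiff≡0⇒≡ (a ∷ x) (b ∷ y) max≡0 = cong₂ _∷_
  (ℤ.i-j≡0⇒i≡j a b (ℤ.∣i∣≡0⇒i≡0 (ℕ.n≤0⇒n≡0 (ℕ.m⊔n≤o⇒m≤o _ _ max≤0))))
  (maxAbsDiff≡0⇒≡ x y (ℕ.n≤0⇒n≡0 (ℕ.m⊔n≤o⇒n≤o _ _ max≤0)))
  where
  max≤0 : (∣ a - b ∣ ⊔ maxAbsDiff x y) ℕ.≤ 0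
  max≤0 = ℕ.≤-reflexive max≡0

maxAbsDiff≡1 : {x y : Pt n} → x ≢ y → (∀ i → ∣ lookup x i - lookup y i ∣ ℕ.≤ 1) →
  maxAbsDiff x y ≡ 1
maxAbsDiff≡1 {x = x} {y} x≢y bound with ℕ.n≤1⇒n≡0∨n≡1 (maxAbsDiff-lub x y bound)
... | inj₁ max≡0 = contradiction (maxAbsDiff≡0⇒≡ x y max≡0) x≢y
... | inj₂ max≡1 = max≡1

Walk-map : ∀ {E E′ : Rel n} {u v} → (∀ {a b} → E a b → E′ a b) → Walk E u v k → Walk E′ u v k
Walk-map f here       = here
Walk-map f (step e p) = step (f e) (Walk-map f p)

Walk⇒f[u]≤k+f[v] : ∀ {E : Rel n} (f : Pt n → ℤ) → (∀ {a b} → E a b → f a ℤ.≤ ℤ.suc (f b)) →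
  ∀ {u v} → Walk E u v k → f u ℤ.≤ + k + f v
Walk⇒f[u]≤k+f[v] f lip {u} here = ℤ.≤-reflexive (sym (ℤ.+-identityˡ (f u)))
Walk⇒f[u]≤k+f[v] f lip {u} {v} (step {v = a} {k = k} e p) = begin
  f u                 ≤⟨ lip e ⟩
  1ℤ + f a            ≤⟨ ℤ.+-monoʳ-≤ 1ℤ (Walk⇒f[u]≤k+f[v] f lip p) ⟩
  1ℤ + (+ k + f v)    ≡⟨ ℤ.+-assoc 1ℤ (+ k) (f v) ⟨
  + suc k + f v       ∎
  where open ℤ.≤-Reasoning

edge⇒lookup≤suc : ∀ {S : List (Pt n)} {E u v} → IsRealization S E → E u v →
  ∀ i → lookup u i ℤ.≤ ℤ.suc (lookup v i)
edge⇒lookup≤suc {u = u} {v} ((endpoints , _) , _ , landmarks) e i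
  with endpoints u v e | landmarks i
... | u∈S , v∈S | _ , _ , _ , coordinate with coordinate u u∈S | coordinate v v∈S
... | ku , u[i]≡ku , (_ , ku-minimal) | kv , v[i]≡kv , (walk-v , _)
  rewrite u[i]≡ku | v[i]≡kv = +≤+ (ku-minimal (suc kv) (step e walk-v))

edge⇒∣lookup-lookup∣≤1 : ∀ {S : List (Pt n)} {E u v} → IsRealization S E → E u v →
  ∀ i → ∣ lookup u i - lookup v i ∣ ℕ.≤ 1
edge⇒∣lookup-lookup∣≤1 {u = u} {v} realization@((_ , _ , symmetric) , _) e i =
  i≤suc[j]⇒j≤suc[i]⇒∣i-j∣≤1
    (edge⇒lookup≤suc realization e i) (edge⇒lookup≤suc realization (symmetric u v e) i)

module _ {S : List (Pt n)} {E : Rel n} {x y : Pt n} (x∈S : x ∈ S) (y∈S : y ∈ S) where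

  addEdge-isGraphOn : x ≢ y → IsGraphOn S E → IsGraphOn S (addEdge E x y)
  addEdge-isGraphOn x≢y (endpoints , irreflexive , symmetric) =
    endpoints′ , irreflexive′ , symmetric′
    where
    endpoints′ : ∀ u v → addEdge E x y u v → u ∈ S × v ∈ S
    endpoints′ u v (inj₁ e)                   = endpoints u v e
    endpoints′ u v (inj₂ (inj₁ (refl , refl))) = x∈S , y∈S
    endpoints′ u v (inj₂ (inj₂ (refl , refl))) = y∈S , x∈S
    irreflexive′ : ∀ u → ¬ addEdge E x y u u
    irreflexive′ u (inj₁ e)                   = irreflexive u e
    irreflexive′ u (inj₂ (inj₁ (refl , refl))) = x≢y refl
    irreflexive′ u (inj₂ (inj₂ (refl , refl))) = x≢y refl
    symmetric′ : ∀ u v → addEdge E x y u v → addEdge E x y v u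
    symmetric′ u v (inj₁ e)             = inj₁ (symmetric u v e)
    symmetric′ u v (inj₂ (inj₁ (p , q))) = inj₂ (inj₂ (q , p))
    symmetric′ u v (inj₂ (inj₂ (p , q))) = inj₂ (inj₁ (q , p))

  addEdge-isRealization : x ≢ y → (∀ i → ∣ lookup x i - lookup y i ∣ ℕ.≤ 1) →
    IsRealization S E → IsRealization S (addEdge E x y)
  addEdge-isRealization x≢y close realization@(graph , connected , landmarks) =
    addEdge-isGraphOn x≢y graph , connected′ , landmarks′
    where
    connected′ : Connected S (addEdge E x y)
    connected′ u v u∈S v∈S with connected u v u∈S v∈S
    ... | k , p = k , Walk-map inj₁ p

    lookup≤suc : ∀ i {a b} → addEdge E x y a b → lookup a i ℤ.≤ ℤ.suc (lookup b i)
    lookup≤suc i (inj₁ e)                   = edge⇒lookup≤suc realization e i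
    lookup≤suc i (inj₂ (inj₁ (refl , refl))) = ∣i-j∣≤1⇒i≤suc[j] (close i)
    lookup≤suc i (inj₂ (inj₂ (refl , refl))) =
      ∣i-j∣≤1⇒i≤suc[j] (subst (ℕ._≤ 1) (∣i-j∣≡∣j-i∣ (lookup x i) (lookup y i)) (close i))

    landmarks′ : ∀ i → Σ (Pt n) λ w → w ∈ S × lookup w i ≡ + 0 ×
      (∀ u → u ∈ S → Σ ℕ λ k → lookup u i ≡ + k × Dist (addEdge E x y) u w k)
    landmarks′ i with landmarks i
    ... | w , w∈S , w[i]≡0 , coordinate = w , w∈S , w[i]≡0 , coordinate′
      where
      coordinate′ : ∀ u → u ∈ S → Σ ℕ λ k → lookup u i ≡ + k × Dist (addEdge E x y) u w k
      coordinate′ u u∈S with coordinate u u∈S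
      ... | k , u[i]≡k , (p , _) = k , u[i]≡k , Walk-map inj₁ p , k-minimal
        where
        k-minimal : ∀ k′ → Walk (addEdge E x y) u w k′ → k ℕ.≤ k′
        k-minimal k′ q = ℤ.drop‿+≤+ (begin
          + k                 ≡⟨ u[i]≡k ⟨
          lookup u i          ≤⟨ Walk⇒f[u]≤k+f[v] (λ a → lookup a i) (lookup≤suc i) q ⟩
          + k′ + lookup w i   ≡⟨ cong (_+_ (+ k′)) w[i]≡0 ⟩
          + k′ + + 0          ≡⟨ ℤ.+-identityʳ (+ k′) ⟩
          + k′                ∎)
          where open ℤ.≤-Reasoning

proposition2p1 : ∀ {n : ℕ} (S : List (Pt n)) (E : Rel n) → IsRealization S E →
    ∀ (x y : Pt n) → x ∈ S → y ∈ S → ¬ x ≡ y → ¬ E x y →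
    (IsRealization S (addEdge E x y) → maxAbsDiff x y ≡ 1) ×
    (maxAbsDiff x y ≡ 1 → IsRealization S (addEdge E x y))
proposition2p1 S E realization x y x∈S y∈S x≢y _ =
  (λ realization′ →
    maxAbsDiff≡1 x≢y (edge⇒∣lookup-lookup∣≤1 realization′ (inj₂ (inj₁ (refl , refl))))) ,
  (λ max≡1 → addEdge-isRealization x∈S y∈S x≢y
    (λ i → subst (∣ lookup x i - lookup y i ∣ ℕ.≤_) max≡1 (∣lookup-lookup∣≤maxAbsDiff x y i))
    realization)
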